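{- Let $m(\mathbf{x},\mathbf{y})=x^py^q\in\mathcal{O}_n$ and let $\sigma\in B_n$ be its signed index permutation. Then $\{q_{|\sigma(i)|}-f_i(\sigma)\}_{i=1}^n$ is a (weakly) decreasing sequence of non-negative even integers.
   Context: $B_n$ is the group of bijections $\sigma$ of $\{ -n,\dots,-1,1,\dots,n\}$ with $\sigma(-k)=-\sigma(k)$. For $\sigma\in B_n$: $\mathrm{Des}(\sigma)=\{1\le i\le n-1:\sigma(i)>\sigma(i+1)\}$; $d_i(\sigma)=|\{j\in\mathrm{Des}(\sigma):j\ge i\}|$; $\varepsilon_i(\sigma)=0$ if $\sigma(i)>0$, $1$ if $\sigma(i)<0$; $f_i(\sigma)=2d_i(\sigma)+\varepsilon_i(\sigma)$. For integers $p=(p_i),q=(q_i)$ non-negative, $x^py^q=\prod x_i^{p_i}y_i^{q_i}$. Let $\mathfrak{s}(a)=a$ if $a$ is even and $-a$ if $a$ is odd. $\mathcal{O}_n$ is the set of monomials $x^py^q$ with $p_k+q_k$ even for all $k$ and $(p_1,\mathfrak{s}(q_1))\ge_\ell\cdots\ge_\ell(p_n,\mathfrak{s}(q_n))$ in lexicographic order (i.e. $p_1\ge\cdots\ge p_n$; if $p_i=p_{i+1}$ even then $q_i\ge q_{i+1}$; if $p_i=p_{i+1}$ odd then $q_i\le q_{i+1}$). The signed index permutation of $x^py^q\in\mathcal{O}_n$ is the unique $\sigma\in B_n$ with: (1) $q_{|\sigma(1)|}\ge\cdots\ge q_{|\sigma(n)|}$; (2) if $0<i<j$ and $q_{|\sigma(i)|}=q_{|\sigma(j)|}$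 then $\sigma(i)<\sigma(i+1)<\cdots<\sigma(j)$; (3) $q_{|\sigma(i)|}$ is even iff $\sigma(i)>0$. -}

module Defs where

open import Data.Nat as ℕ using (ℕ; zero; suc)
open import Data.Nat.Divisibility as ℕD using ()
open import Data.Integer as ℤ using (ℤ; +_; -[1+_])
open import Data.Fin using (Fin; toℕ)
open import Data.Fin.Permutation using (Permutation′; _⟨$⟩ʳ_)
open import Data.Bool using (Bool; true; false; if_then_else_)
open import Data.List using (List; []; _∷_; drop; map)
open import Data.Product using (_×_)
import Relation.Nullary
open import Relation.Binary.PropositionalEquality using (_≡_)
open import Data.List.Base using (allFin) public

-- Indices are 0-based: position i ∈ Fin n stands for position (toℕ i + 1).

Next : {n : ℕ} → Fin n → Fin n → Set
Next i j = toℕ j ≡ suc (toℕ i)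

-- An element of B_n: σ(i) = ± (π(i) + 1), the sign being negative iff neg i.
-- (Such pairs (π , neg) are in bijection with B_n, since σ(-k) = -σ(k).)
record SignedPerm (n : ℕ) : Set where
  constructor mkSP
  field
    perm : Permutation′ n
    neg  : Fin n → Bool
open SignedPerm public

absIdx : {n : ℕ} → SignedPerm n → Fin n → Fin n
absIdx σ i = perm σ ⟨$⟩ʳ i

val : {n : ℕ} → SignedPerm n → Fin n → ℤ
val σ i = if neg σ i then -[1+ toℕ (absIdx σ i) ] else + suc (toℕ (absIdx σ i))

eps : {n : ℕ} → SignedPerm n → Fin n → ℕ
eps σ i = if neg σ i then 1 else 0

descentsFrom : ℤ → List ℤ → ℕ
descentsFrom x [] = 0
descentsFrom x (y ∷ r) = (if Relation.Nullary.does (y ℤ.<? x) then 1 else 0) ℕ.+ descentsFrom y r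

descents : List ℤ → ℕ
descents [] = 0
descents (x ∷ r) = descentsFrom x r

window : {n : ℕ} → SignedPerm n → List ℤ
window {n} σ = map (val σ) (allFin n)

-- d_i(σ) = #{ j ∈ Des(σ) : j ≥ i }  (i 1-based = toℕ i + 1)
dstat : {n : ℕ} → SignedPerm n → Fin n → ℕ
dstat σ i = descents (drop (toℕ i) (window σ))

fstat : {n : ℕ} → SignedPerm n → Fin n → ℕ
fstat σ i = 2 ℕ.* dstat σ i ℕ.+ eps σ i

Even : ℕ → Set
Even a = 2 ℕD.∣ a

InO : {n : ℕ} → (p q : Fin n → ℕ) → Set
InO {n} p q =
  ((k : Fin n) → Even (p k ℕ.+ q k)) ×
  ((i j : Fin n) → Next i j →
     (p j ℕ.≤ p i) ×
     ((p i ≡ p j → Even (p i) → q j ℕ.≤ q i) ×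
      (p i ≡ p j → (Even (p i) → Data.Empty.⊥) → q i ℕ.≤ q j)))
  where import Data.Empty

IsSignedIndexPerm : {n : ℕ} → (q : Fin n → ℕ) → SignedPerm n → Set
IsSignedIndexPerm {n} q σ =
  ((i j : Fin n) → Next i j → q (absIdx σ j) ℕ.≤ q (absIdx σ i)) ×
  ((i j : Fin n) → toℕ i ℕ.< toℕ j → q (absIdx σ i) ≡ q (absIdx σ j) →
     (k l : Fin n) → Next k l → toℕ i ℕ.≤ toℕ k → toℕ l ℕ.≤ toℕ j →
     val σ k ℤ.< val σ l) ×
  ((i : Fin n) → (Even (q (absIdx σ i)) → neg σ i ≡ false) ×
                 (neg σ i ≡ false → Even (q (absIdx σ i))))

entry : {n : ℕ} → (q : Fin n → ℕ) → SignedPerm n → Fin n → ℤ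
entry q σ i = + q (absIdx σ i) ℤ.- + fstat σ i

-- Write r i = q_{|σ(i)|}. Condition (3) says that r i has the parity ε_i, so
-- r i = 2 k i + ε_i with k i = ⌊r i / 2⌋. Condition (1) gives k (i+1) ≤ k i, and across a
-- descent σ(i) > σ(i+1) condition (2) forces r (i+1) < r i while the signs force
-- ε_i ≤ ε_(i+1), so that even k (i+1) < k i. Since d_i = [i ∈ Des] + d_(i+1), downward
-- induction gives d_i ≤ k i and shows that k i - d_i decreases weakly; the i-th entry of
-- the sequence is 2 (k i - d_i).
module Submission where

open import Defs
open import Data.Nat using (ℕ)
open import Data.Fin using (Fin)
open import Data.Integer using (+_; _≤_)
open import Data.Integer.Divisibility using (_∣_)
open import Data.Product using (_×_)

open import Data.Nat as ℕ using (zero; suc; z≤n; s≤s; _∸_; _/_; _%_)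
open import Data.Nat.Properties
open import Data.Nat.DivMod using (m≡m%n+[m/n]*n; m%n<n; /-monoˡ-≤)
open import Data.Nat.Divisibility using (divides; m%n≡0⇒n∣m; n∣m⇒m%n≡0)
import Data.Integer as ℤ
import Data.Integer.Properties as ℤP
open import Data.Fin using (toℕ; fromℕ<)
open import Data.Fin.Properties using (toℕ<n; toℕ-fromℕ<)
open import Data.Bool using (true; false; if_then_else_)
open import Data.List using (List; _∷_; drop; tabulate; length)
open import Data.List.Properties using (drop-all; map-tabulate; length-tabulate)
open import Data.Product using (_,_; proj₁; proj₂)
open import Function using (_∘_)
open import Relation.Nullary using (yes; no; does; ¬_; contradiction)
open import Relation.Binary.PropositionalEquality

fin-downward-induction : ∀ {n} (P : Fin n → Set) →
  (∀ i → suc (toℕ i) ≡ n → P i) →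
  (∀ i j → Next i j → P j → P i) →
  ∀ i → P i
fin-downward-induction {n} P last step i = go (n ∸ toℕ i) i (m+[n∸m]≡n (<⇒≤ (toℕ<n i)))
  where
  go : ∀ t i → toℕ i ℕ.+ t ≡ n → P i
  go zero i e = contradiction (trans (sym (+-identityʳ _)) e) (<⇒≢ (toℕ<n i))
  go (suc t) i e with suc (toℕ i) ℕ.<? n
  ... | no i+1≮n = last i (≤-antisym (toℕ<n i) (ℕ.s≤s⁻¹ (≰⇒> i+1≮n)))
  ... | yes i+1<n = step i j next (go t j j+t≡n)
    where
    j = fromℕ< i+1<n
    next : Next i j
    next = toℕ-fromℕ< i+1<n
    j+t≡n : toℕ j ℕ.+ t ≡ n
    j+t≡n = trans (cong (ℕ._+ t) next) (trans (sym (+-suc (toℕ i) t)) e)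

drop-tabulate : ∀ {A : Set} {n} (f : Fin n → A) (i : Fin n) →
  drop (toℕ i) (tabulate f) ≡ f i ∷ drop (suc (toℕ i)) (tabulate f)
drop-tabulate {n = suc n} f Fin.zero = refl
drop-tabulate {n = suc n} f (Fin.suc i) = drop-tabulate (f ∘ Fin.suc) i

m<n∧n%2≤m%2⇒m/2<n/2 : ∀ {m n} → m ℕ.< n → n % 2 ℕ.≤ m % 2 → m / 2 ℕ.< n / 2
m<n∧n%2≤m%2⇒m/2<n/2 {m} {n} m<n n%2≤m%2 = ≰⇒> n/2≰m/2
  where
  n/2≰m/2 : ¬ (n / 2 ℕ.≤ m / 2)
  n/2≰m/2 n/2≤m/2 = <⇒≱ m<n (begin
    n                     ≡⟨ m≡m%n+[m/n]*n n 2 ⟩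
    n % 2 ℕ.+ n / 2 ℕ.* 2 ≤⟨ +-mono-≤ n%2≤m%2 (*-monoˡ-≤ 2 n/2≤m/2) ⟩
    m % 2 ℕ.+ m / 2 ℕ.* 2 ≡⟨ sym (m≡m%n+[m/n]*n m 2) ⟩
    m                     ∎)
    where open ≤-Reasoning

module SignedIndexPermutation {n : ℕ} (q : Fin n → ℕ) (σ : SignedPerm n) (sip : IsSignedIndexPerm q σ) where

  private
    weaklyDecreasing = proj₁ sip
    increasingOnTies = proj₁ (proj₂ sip)
    signIsParity     = proj₂ (proj₂ sip)

  qAbs : Fin n → ℕ
  qAbs i = q (absIdx σ i)

  halfQ : Fin n → ℕ
  halfQ i = qAbs i / 2

  descentAt : Fin n → Fin n → ℕ
  descentAt i j = if does (val σ j ℤ.<? val σ i) then 1 else 0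

  qAbs%2≡eps : ∀ i → qAbs i % 2 ≡ eps σ i
  qAbs%2≡eps i with neg σ i in negᵢ
  ... | false = n∣m⇒m%n≡0 (qAbs i) 2 (proj₂ (signIsParity i) negᵢ)
  ... | true with qAbs i % 2 in qAbs%2 | m%n<n (qAbs i) 2
  ...   | 0 | _ = contradiction (trans (sym negᵢ) (proj₁ (signIsParity i) (m%n≡0⇒n∣m (qAbs i) 2 qAbs%2))) λ ()
  ...   | 1 | _ = refl
  ...   | suc (suc _) | s≤s (s≤s ())

  qAbs≡eps+2*halfQ : ∀ i → qAbs i ≡ eps σ i ℕ.+ 2 ℕ.* halfQ i
  qAbs≡eps+2*halfQ i = trans (m≡m%n+[m/n]*n (qAbs i) 2) (cong₂ ℕ._+_ (qAbs%2≡eps i) (*-comm (halfQ i) 2))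

  -- A negative entry lies below every positive one, so a descent never goes from − to +.
  descent⇒eps≤eps : ∀ {i j} → val σ j ℤ.< val σ i → eps σ i ℕ.≤ eps σ j
  descent⇒eps≤eps {i} {j} lt with neg σ i | neg σ j
  ... | true  | true  = ≤-refl
  ... | true  | false = contradiction lt λ ()
  ... | false | _     = z≤n

  descentAt+halfQ≤halfQ : ∀ i j → Next i j → descentAt i j ℕ.+ halfQ j ℕ.≤ halfQ i
  descentAt+halfQ≤halfQ i j next with val σ j ℤ.<? val σ i
  ... | no _ = /-monoˡ-≤ 2 (weaklyDecreasing i j next)
  ... | yes lt with qAbs i ℕ.≟ qAbs j
  ...   | yes qᵢ≡qⱼ = contradiction (increasingOnTies i j i<j qᵢ≡qⱼ i j next ≤-refl ≤-refl) (ℤP.<-asym lt)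
    where i<j = subst (toℕ i ℕ.<_) (sym next) ≤-refl
  ...   | no qᵢ≢qⱼ = m<n∧n%2≤m%2⇒m/2<n/2 (≤∧≢⇒< (weaklyDecreasing i j next) (qᵢ≢qⱼ ∘ sym))
                       (subst₂ ℕ._≤_ (sym (qAbs%2≡eps i)) (sym (qAbs%2≡eps j)) (descent⇒eps≤eps lt))

  private
    values : List ℤ.ℤ
    values = tabulate (val σ)

    dstat≡descents-drop : ∀ i → dstat σ i ≡ descents (drop (toℕ i) values)
    dstat≡descents-drop i = cong (descents ∘ drop (toℕ i)) (map-tabulate (λ j → j) (val σ))

  dstat-step : ∀ i j → Next i j → dstat σ i ≡ descentAt i j ℕ.+ dstat σ j
  dstat-step i j next = begin
    dstat σ i
      ≡⟨ dstat≡descents-drop i ⟩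
    descents (drop (toℕ i) values)
      ≡⟨ cong descents (drop-tabulate (val σ) i) ⟩
    descents (val σ i ∷ drop (suc (toℕ i)) values)
      ≡⟨ cong (λ m → descents (val σ i ∷ drop m values)) (sym next) ⟩
    descents (val σ i ∷ drop (toℕ j) values)
      ≡⟨ cong (descents ∘ (val σ i ∷_)) (drop-tabulate (val σ) j) ⟩
    descentAt i j ℕ.+ descents (val σ j ∷ drop (suc (toℕ j)) values)
      ≡⟨ cong (descentAt i j ℕ.+_) (sym (trans (dstat≡descents-drop j) (cong descents (drop-tabulate (val σ) j)))) ⟩
    descentAt i j ℕ.+ dstat σ j
      ∎
    where open ≡-Reasoning

  dstat-last : ∀ i → suc (toℕ i) ≡ n → dstat σ i ≡ 0
  dstat-last i i+1≡n = begin
    dstat σ i                                      ≡⟨ dstat≡descents-drop i ⟩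
    descents (drop (toℕ i) values)                 ≡⟨ cong descents (drop-tabulate (val σ) i) ⟩
    descents (val σ i ∷ drop (suc (toℕ i)) values) ≡⟨ cong (descents ∘ (val σ i ∷_)) (drop-all _ values length-values≤i+1) ⟩
    0                                              ∎
    where
    open ≡-Reasoning
    length-values≤i+1 : length values ℕ.≤ suc (toℕ i)
    length-values≤i+1 = ≤-reflexive (trans (length-tabulate (val σ)) (sym i+1≡n))

  dstat≤halfQ : ∀ i → dstat σ i ℕ.≤ halfQ i
  dstat≤halfQ = fin-downward-induction (λ i → dstat σ i ℕ.≤ halfQ i)
    (λ i i+1≡n → subst (ℕ._≤ halfQ i) (sym (dstat-last i i+1≡n)) z≤n)
    (λ i j next dⱼ≤kⱼ → begin
       dstat σ i                   ≡⟨ dstat-step i j next ⟩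
       descentAt i j ℕ.+ dstat σ j ≤⟨ +-monoʳ-≤ (descentAt i j) dⱼ≤kⱼ ⟩
       descentAt i j ℕ.+ halfQ j   ≤⟨ descentAt+halfQ≤halfQ i j next ⟩
       halfQ i                     ∎)
    where open ≤-Reasoning

  gap : Fin n → ℕ
  gap i = halfQ i ∸ dstat σ i

  entry≡2*gap : ∀ i → entry q σ i ≡ + (2 ℕ.* gap i)
  entry≡2*gap i = begin
    entry q σ i
      ≡⟨ ℤP.m-n≡m⊖n (qAbs i) (fstat σ i) ⟩
    qAbs i ℤ.⊖ fstat σ i
      ≡⟨ ℤP.⊖-≥ fstat≤qAbs ⟩
    + (qAbs i ∸ fstat σ i)
      ≡⟨ cong +_ (cong₂ _∸_ (qAbs≡eps+2*halfQ i) (+-comm (2 ℕ.* dstat σ i) (eps σ i))) ⟩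
    + ((eps σ i ℕ.+ 2 ℕ.* halfQ i) ∸ (eps σ i ℕ.+ 2 ℕ.* dstat σ i))
      ≡⟨ cong +_ ([m+n]∸[m+o]≡n∸o (eps σ i) _ _) ⟩
    + (2 ℕ.* halfQ i ∸ 2 ℕ.* dstat σ i)
      ≡⟨ cong +_ (sym (*-distribˡ-∸ 2 (halfQ i) (dstat σ i))) ⟩
    + (2 ℕ.* gap i)
      ∎
    where
    open ≡-Reasoning
    fstat≤qAbs : fstat σ i ℕ.≤ qAbs i
    fstat≤qAbs = subst₂ ℕ._≤_ (+-comm (eps σ i) _) (sym (qAbs≡eps+2*halfQ i))
                   (+-monoʳ-≤ (eps σ i) (*-monoʳ-≤ 2 (dstat≤halfQ i)))

  gap-antitone : ∀ i j → Next i j → gap j ℕ.≤ gap i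
  gap-antitone i j next = begin
    halfQ j ∸ dstat σ j
      ≡⟨ sym ([m+n]∸[m+o]≡n∸o (descentAt i j) (halfQ j) (dstat σ j)) ⟩
    (descentAt i j ℕ.+ halfQ j) ∸ (descentAt i j ℕ.+ dstat σ j)
      ≤⟨ ∸-monoˡ-≤ (descentAt i j ℕ.+ dstat σ j) (descentAt+halfQ≤halfQ i j next) ⟩
    halfQ i ∸ (descentAt i j ℕ.+ dstat σ j)
      ≡⟨ cong (halfQ i ∸_) (sym (dstat-step i j next)) ⟩
    halfQ i ∸ dstat σ i
      ∎
    where open ≤-Reasoning

mainTheorem3 : (n : ℕ) (p q : Fin n → ℕ) (σ : SignedPerm n) →
    InO p q → IsSignedIndexPerm q σ →
    ((i : Fin n) → (+ 0 ≤ entry q σ i) × (+ 2 ∣ entry q σ i)) ×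
    ((i j : Fin n) → Next i j → entry q σ j ≤ entry q σ i)
mainTheorem3 n p q σ _ sip =
  (λ i → subst (+ 0 ≤_) (sym (entry≡2*gap i)) (ℤ.+≤+ z≤n) ,
         subst (+ 2 ∣_) (sym (entry≡2*gap i)) (divides (gap i) (*-comm 2 (gap i)))) ,
  (λ i j next → subst₂ _≤_ (sym (entry≡2*gap j)) (sym (entry≡2*gap i)) (ℤ.+≤+ (*-monoʳ-≤ 2 (gap-antitone i j next))))
  where open SignedIndexPermutation q σ sip
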